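{- Let $\mathcal R$ be a weak bisimulation with $M\,\mathcal R\,m$ ($M$ a decentralized monitor, $m$ a centralized monitor). Then for every hypertrace $T\in\mathsf{HTrc}_{\mathcal L}$ and every verdict $v$: $M\triangleright T\rightarrowtail^* v$ if and only if $m\triangleright T\rightarrowtail^* v$.
   Context: Model. Fix a finite set $\mathsf{Act}$ of actions with $|\mathsf{Act}|\ge 2$ and a finite non-empty set $\mathcal L$ of locations. $\mathsf{Trc}=\mathsf{Act}^\omega$; a hypertrace is $T:\mathcal L\to\mathsf{Trc}$, $\mathsf{HTrc}_{\mathcal L}$ is the set of hypertraces; for $A:\mathcal L\to\mathsf{Act}$, $T\xrightarrow{A}T'$ iff $T(\ell)=A(\ell)\,T'(\ell)$ for all $\ell$. Centralized monitors: $m::=\mathsf{yes}\mid\mathsf{no}\mid\mathsf{end}\mid a_\ell.m\mid m+m\mid m\oplus m\mid m\otimes m\mid\mathsf{rec}\,x.m\mid x$; verdicts $v\in\{\mathsf{yes},\mathsf{no},\mathsf{end}\}$; $\odot\in\{\otimes,\oplus\}$. Transitions $m\xrightarrow{A}m'$ (least relation): $v\xrightarrow{A}v$; $a_\ell.m\xrightarrow{A}m$ if $A(\ell)=a$; $a_\ell.m\xrightarrow{A}\mathsf{end}$ if $A(\ell)\neq a$; $\mathsf{rec}\,x.m\xrightarrow{A}m'$ if $m\{\mathsf{rec}\,x.m/x\}\xrightarrow{A}m'$; $m+n\xrightarrow{A}m'$ if $m\xrightarrow{A}m'$, $m+n\xrightarrow{A}n'$ if $n\xrightarrow{A}n'$;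 $m\odot n\xrightarrow{A}m'\odot n'$ if $m\xrightarrow{A}m'$ and $n\xrightarrow{A}n'$. Verdict evaluation $m\Rrightarrow v$: least relation closed under (each also with operands of $+,\otimes,\oplus$ swapped) $v\Rrightarrow v$; $m\odot n\Rrightarrow\mathsf{end}$ if both $\Rrightarrow\mathsf{end}$; $m\oplus n\Rrightarrow\mathsf{yes}$ if $m\Rrightarrow\mathsf{yes}$; $m\otimes n\Rrightarrow\mathsf{no}$ if $m\Rrightarrow\mathsf{no}$; $m+n\Rrightarrow v$ if $m\Rrightarrow v$; $m\oplus n\Rrightarrow v$ if $m\Rrightarrow\mathsf{no}$ and $n\Rrightarrow v$; $m\otimes n\Rrightarrow v$ if $m\Rrightarrow\mathsf{yes}$ and $n\Rrightarrow v$; $\mathsf{rec}\,x.m\Rrightarrow v$ if $m\{\mathsf{rec}\,x.m/x\}\Rrightarrow v$. Centralized instrumentation: $m\triangleright T\rightarrowtail m'\triangleright T'$ if $m\xrightarrow{A}m'$, $T\xrightarrow{A}T'$; $m\triangleright T\rightarrowtail v$ if $m\Rrightarrow v$. Decentralized monitors. Let $\mathsf{Con}\supseteq\mathsf{Act}$ be a finite set of communication constants; communication actions are $(!G,\gamma)$ and $(?G,\gamma)$ with $G\subseteq\mathcal L$, $\gamma\in\mathsf{Con}$. Decentralized monitors $M::=[m]_\ell\mid M\vee M\mid M\wedge M$; local monitors $m::=\mathsf{yes}\mid\mathsf{no}\mid\mathsf{end}\mid a.m\mid c.m\mid m+m\mid m\oplus m\mid m\otimes m\mid\mathsf{rec}\,x.m\mid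 x$ ($a\in\mathsf{Act}$, $c$ a communication action). Local transitions, labels $\lambda\in\mathsf{Act}\cup\{(!G,\gamma)\}\cup\{(?\ell,\gamma)\mid\ell\in\mathcal L\}$ (rules also with operands of $+,\otimes,\oplus$ swapped): $a.m\xrightarrow{a}m$; $(?G,\gamma).m\xrightarrow{(?\ell,\gamma)}m$ if $\ell\in G$; $(!G,\gamma).m\xrightarrow{(!G,\gamma)}m$; $v\xrightarrow{a}v$; $\mathsf{rec}\,x.m\xrightarrow{\lambda}m'$ if $m\{\mathsf{rec}\,x.m/x\}\xrightarrow{\lambda}m'$; $m\odot n\xrightarrow{a}m'\odot n'$ if $m\xrightarrow{a}m'$ and $n\xrightarrow{a}n'$; $m\odot n\xrightarrow{(?\ell,\gamma)}m'\odot n'$ if both make that transition; $m+n\xrightarrow{\lambda}m'$ if $m\xrightarrow{\lambda}m'$; $m\odot n\xrightarrow{(!G,\gamma)}m'\odot n$ if $m\xrightarrow{(!G,\gamma)}m'$; $m\odot n\xrightarrow{(?\ell,\gamma)}m'\odot n$ if $m\xrightarrow{(?\ell,\gamma)}m'$ and $n$ has no $(?\ell,\gamma)$-transition. Decentralized rules ($\diamond\in\{\wedge,\vee\}$, also with operands swapped): $[m]_\ell\xrightarrow{\ell:(!G,\gamma)}[m']_\ell$ if $m\xrightarrow{(!G,\gamma)}m'$; reception judgement $[m]_\ell\overset{G:(?\ell',\gamma)}{\rightsquigarrow}[m']_\ell$ if $m\xrightarrow{(?\ell',\gamma)}m'$ and $\ell\in G$; $[m]_\ell\overset{G:(?\ell',\gamma)}{\rightsquigarrow}[m]_\ell$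 if $m$ has no $(?\ell',\gamma)$-transition or if $\ell\notin G$; $M\diamond N\overset{G:(?\ell,\gamma)}{\rightsquigarrow}M'\diamond N'$ if both components do; $M\diamond N\xrightarrow{\ell:(!G,\gamma)}M'\diamond N'$ if $M\xrightarrow{\ell:(!G,\gamma)}M'$ and $N\overset{G:(?\ell,\gamma)}{\rightsquigarrow}N'$. Action steps: $[m]_\ell\xrightarrow{A}[m']_\ell$ if $A(\ell)=a$ and $m\xrightarrow{a}m'$; $[m]_\ell\xrightarrow{A}[\mathsf{end}]_\ell$ if $A(\ell)=a$, $m$ has no $a$-transition and no transition labelled by a communication action; $M\diamond N\xrightarrow{A}M'\diamond N'$ if $M\xrightarrow{A}M'$ and $N\xrightarrow{A}N'$. Verdicts: $[m]_\ell\Rrightarrow v$ if $m\Rrightarrow v$ (verdict rules above applied to local monitors); $M\diamond N\Rrightarrow\mathsf{end}$ if both $\Rrightarrow\mathsf{end}$; $M\wedge N\Rrightarrow\mathsf{no}$ if $M\Rrightarrow\mathsf{no}$; $M\wedge N\Rrightarrow v$ if $M\Rrightarrow\mathsf{yes}$ and $N\Rrightarrow v$; $M\vee N\Rrightarrow\mathsf{yes}$ if $M\Rrightarrow\mathsf{yes}$; $M\vee N\Rrightarrow v$ if $M\Rrightarrow\mathsf{no}$ and $N\Rrightarrow v$ (also with operands swapped). Decentralized instrumentation: $M\triangleright T\rightarrowtail M'\triangleright T'$ if $M\xrightarrow{A}M'$ and $T\xrightarrow{A}T'$; $M\triangleright T\rightarrowtail M'\triangleright T$ if $M\xrightarrow{\ell:(!G,\gamma)}M'$;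 $M\triangleright T\rightarrowtail v$ if $M\Rrightarrow v$. $\rightarrowtail^*$ is the reflexive-transitive closure. Write $M\Rightarrow_c M'$ if $M'$ is reached from $M$ by a finite (possibly empty) sequence of transitions labelled $\ell_i:(!G_i,\gamma_i)$. Weak bisimulation: a relation $\mathcal R$ between decentralized and centralized monitors such that whenever $M\,\mathcal R\,m$: (1) for every verdict $v$, there exists $M'$ with $M\Rightarrow_c M'$ and $M'\Rrightarrow v$ if and only if $m\Rrightarrow v$; (2) if $M\xrightarrow{A}M'$ then there is $m'$ with $m\xrightarrow{A}m'$ and $M'\,\mathcal R\,m'$; (3) if $M\xrightarrow{\ell:(!G,\gamma)}M'$ then $M'\,\mathcal R\,m$; (4) if $m\xrightarrow{A}m'$ then there exist $M_1,M_2,M'$ with $M\Rightarrow_c M_1\xrightarrow{A}M_2\Rightarrow_c M'$ and $M'\,\mathcal R\,m'$. -}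

module Defs where

open import Data.Nat using (ℕ; zero; suc)
open import Data.Fin using (Fin)
open import Data.Fin.Subset using (Subset; _∈_; _∉_)
open import Data.Sum using (_⊎_; inj₁; inj₂)
open import Data.Product using (Σ; ∃; _×_; _,_)
open import Relation.Nullary using (¬_)
open import Relation.Binary.PropositionalEquality using (_≡_; _≢_)
open import Relation.Binary.Construct.Closure.ReflexiveTransitive using (Star)

-- Verdicts and a generic monitor syntax (shared by centralized and
-- local monitors; they differ only in the prefix type P).
-- Recursion variables are de Bruijn indices: rec m binds var 0 in m.

data Verdict : Set where
  yes no end : Verdict

infixr 6 _·_
infixl 4 _+_ _⊕_ _⊗_

data Mon (P : Set) : Set where
  verd : Verdict → Mon P
  _·_  : P → Mon P → Mon P
  _+_  : Mon P → Mon P → Mon P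
  _⊕_  : Mon P → Mon P → Mon P
  _⊗_  : Mon P → Mon P → Mon P
  rec  : Mon P → Mon P
  var  : ℕ → Mon P

module _ {P : Set} where

  ext : (ℕ → ℕ) → ℕ → ℕ
  ext ρ zero    = zero
  ext ρ (suc n) = suc (ρ n)

  ren : (ℕ → ℕ) → Mon P → Mon P
  ren ρ (verd v) = verd v
  ren ρ (p · m)  = p · ren ρ m
  ren ρ (m + n)  = ren ρ m + ren ρ n
  ren ρ (m ⊕ n)  = ren ρ m ⊕ ren ρ n
  ren ρ (m ⊗ n)  = ren ρ m ⊗ ren ρ n
  ren ρ (rec m)  = rec (ren (ext ρ) m)
  ren ρ (var x)  = var (ρ x)

  exts : (ℕ → Mon P) → ℕ → Mon P
  exts σ zero    = var zero
  exts σ (suc n) = ren suc (σ n)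

  sub : (ℕ → Mon P) → Mon P → Mon P
  sub σ (verd v) = verd v
  sub σ (p · m)  = p · sub σ m
  sub σ (m + n)  = sub σ m + sub σ n
  sub σ (m ⊕ n)  = sub σ m ⊕ sub σ n
  sub σ (m ⊗ n)  = sub σ m ⊗ sub σ n
  sub σ (rec m)  = rec (sub (exts σ) m)
  sub σ (var x)  = σ x

  sub₀ : Mon P → ℕ → Mon P
  sub₀ N zero    = N
  sub₀ N (suc n) = var n

  unfold : Mon P → Mon P
  unfold m = sub (sub₀ (rec m)) m

  infix 3 _⇛_
  data _⇛_ : Mon P → Verdict → Set where
    ⇛verd   : ∀ {v} → verd v ⇛ v
    ⇛⊕end   : ∀ {m n} → m ⇛ end → n ⇛ end → m ⊕ n ⇛ end
    ⇛⊗end   : ∀ {m n} → m ⇛ end → n ⇛ end → m ⊗ n ⇛ end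
    ⇛⊕yesˡ  : ∀ {m n} → m ⇛ yes → m ⊕ n ⇛ yes
    ⇛⊕yesʳ  : ∀ {m n} → n ⇛ yes → m ⊕ n ⇛ yes
    ⇛⊗noˡ   : ∀ {m n} → m ⇛ no → m ⊗ n ⇛ no
    ⇛⊗noʳ   : ∀ {m n} → n ⇛ no → m ⊗ n ⇛ no
    ⇛+ˡ     : ∀ {m n v} → m ⇛ v → m + n ⇛ v
    ⇛+ʳ     : ∀ {m n v} → n ⇛ v → m + n ⇛ v
    ⇛⊕noˡ   : ∀ {m n v} → m ⇛ no → n ⇛ v → m ⊕ n ⇛ v
    ⇛⊕noʳ   : ∀ {m n v} → n ⇛ no → m ⇛ v → m ⊕ n ⇛ v
    ⇛⊗yesˡ  : ∀ {m n v} → m ⇛ yes → n ⇛ v → m ⊗ n ⇛ v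
    ⇛⊗yesʳ  : ∀ {m n v} → n ⇛ yes → m ⇛ v → m ⊗ n ⇛ v
    ⇛rec    : ∀ {m v} → unfold m ⇛ v → rec m ⇛ v

module _ (nA nL nE : ℕ) where

  Act : Set
  Act = Fin nA

  Loc : Set
  Loc = Fin nL

  Con : Set
  Con = Act ⊎ Fin nE

  Trc : Set
  Trc = ℕ → Act

  HTrc : Set
  HTrc = Loc → Trc

  Assign : Set
  Assign = Loc → Act

  TStep : HTrc → Assign → HTrc → Set
  TStep T A T' = ∀ ℓ → (T ℓ zero ≡ A ℓ) × (∀ k → T ℓ (suc k) ≡ T' ℓ k)

  CMon : Set
  CMon = Mon (Act × Loc)

  data CStep : CMon → Assign → CMon → Set where
    cverd  : ∀ {v A} → CStep (verd v) A (verd v)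
    cpre   : ∀ {a ℓ m A} → A ℓ ≡ a → CStep ((a , ℓ) · m) A m
    cpreE  : ∀ {a ℓ m A} → A ℓ ≢ a → CStep ((a , ℓ) · m) A (verd end)
    crec   : ∀ {m m' A} → CStep (unfold m) A m' → CStep (rec m) A m'
    c+ˡ    : ∀ {m n m' A} → CStep m A m' → CStep (m + n) A m'
    c+ʳ    : ∀ {m n n' A} → CStep n A n' → CStep (m + n) A n'
    c⊕     : ∀ {m n m' n' A} → CStep m A m' → CStep n A n' → CStep (m ⊕ n) A (m' ⊕ n')
    c⊗     : ∀ {m n m' n' A} → CStep m A m' → CStep n A n' → CStep (m ⊗ n) A (m' ⊗ n')

  data CConf : Set where
    _▷_  : CMon → HTrc → CConf
    done : Verdict → CConf

  data CInstr : CConf → CConf → Set where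
    cstep : ∀ {m m' T T' A} → CStep m A m' → TStep T A T' → CInstr (m ▷ T) (m' ▷ T')
    cverdict : ∀ {m T v} → m ⇛ v → CInstr (m ▷ T) (done v)

  data CommAct : Set where
    snd : Subset nL → Con → CommAct
    rcv : Subset nL → Con → CommAct

  LMon : Set
  LMon = Mon (Act ⊎ CommAct)

  data Label : Set where
    act   : Act → Label
    lsnd  : Subset nL → Con → Label
    lrcv  : Loc → Con → Label

  IsComm : Label → Set
  IsComm (act _)    = Data.Empty.⊥ where import Data.Empty
  IsComm (lsnd _ _) = Data.Unit.⊤ where import Data.Unit
  IsComm (lrcv _ _) = Data.Unit.⊤ where import Data.Unit

  -- "n has a (?ℓ,γ)-transition", defined positively (stratification of the
  -- negative premise in the rules for ⊙)
  data HasRcv (ℓ : Loc) (γ : Con) : LMon → Set where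
    hpre  : ∀ {G m} → ℓ ∈ G → HasRcv ℓ γ (inj₂ (rcv G γ) · m)
    hrec  : ∀ {m} → HasRcv ℓ γ (unfold m) → HasRcv ℓ γ (rec m)
    h+ˡ   : ∀ {m n} → HasRcv ℓ γ m → HasRcv ℓ γ (m + n)
    h+ʳ   : ∀ {m n} → HasRcv ℓ γ n → HasRcv ℓ γ (m + n)
    h⊕ˡ   : ∀ {m n} → HasRcv ℓ γ m → HasRcv ℓ γ (m ⊕ n)
    h⊕ʳ   : ∀ {m n} → HasRcv ℓ γ n → HasRcv ℓ γ (m ⊕ n)
    h⊗ˡ   : ∀ {m n} → HasRcv ℓ γ m → HasRcv ℓ γ (m ⊗ n)
    h⊗ʳ   : ∀ {m n} → HasRcv ℓ γ n → HasRcv ℓ γ (m ⊗ n)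

  data LStep : LMon → Label → LMon → Set where
    lact   : ∀ {a m} → LStep (inj₁ a · m) (act a) m
    lrcvP  : ∀ {G γ ℓ m} → ℓ ∈ G → LStep (inj₂ (rcv G γ) · m) (lrcv ℓ γ) m
    lsndP  : ∀ {G γ m} → LStep (inj₂ (snd G γ) · m) (lsnd G γ) m
    lverd  : ∀ {v a} → LStep (verd v) (act a) (verd v)
    lrec   : ∀ {m λ' m'} → LStep (unfold m) λ' m' → LStep (rec m) λ' m'
    l+ˡ    : ∀ {m n λ' m'} → LStep m λ' m' → LStep (m + n) λ' m'
    l+ʳ    : ∀ {m n λ' n'} → LStep n λ' n' → LStep (m + n) λ' n'
    l⊕act  : ∀ {m n m' n' a} → LStep m (act a) m' → LStep n (act a) n' → LStep (m ⊕ n) (act a) (m' ⊕ n')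
    l⊕rcv  : ∀ {m n m' n' ℓ γ} → LStep m (lrcv ℓ γ) m' → LStep n (lrcv ℓ γ) n' → LStep (m ⊕ n) (lrcv ℓ γ) (m' ⊕ n')
    l⊕sndˡ : ∀ {m n m' G γ} → LStep m (lsnd G γ) m' → LStep (m ⊕ n) (lsnd G γ) (m' ⊕ n)
    l⊕sndʳ : ∀ {m n n' G γ} → LStep n (lsnd G γ) n' → LStep (m ⊕ n) (lsnd G γ) (m ⊕ n')
    l⊕rcvˡ : ∀ {m n m' ℓ γ} → LStep m (lrcv ℓ γ) m' → ¬ HasRcv ℓ γ n → LStep (m ⊕ n) (lrcv ℓ γ) (m' ⊕ n)
    l⊕rcvʳ : ∀ {m n n' ℓ γ} → LStep n (lrcv ℓ γ) n' → ¬ HasRcv ℓ γ m → LStep (m ⊕ n) (lrcv ℓ γ) (m ⊕ n')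
    l⊗act  : ∀ {m n m' n' a} → LStep m (act a) m' → LStep n (act a) n' → LStep (m ⊗ n) (act a) (m' ⊗ n')
    l⊗rcv  : ∀ {m n m' n' ℓ γ} → LStep m (lrcv ℓ γ) m' → LStep n (lrcv ℓ γ) n' → LStep (m ⊗ n) (lrcv ℓ γ) (m' ⊗ n')
    l⊗sndˡ : ∀ {m n m' G γ} → LStep m (lsnd G γ) m' → LStep (m ⊗ n) (lsnd G γ) (m' ⊗ n)
    l⊗sndʳ : ∀ {m n n' G γ} → LStep n (lsnd G γ) n' → LStep (m ⊗ n) (lsnd G γ) (m ⊗ n')
    l⊗rcvˡ : ∀ {m n m' ℓ γ} → LStep m (lrcv ℓ γ) m' → ¬ HasRcv ℓ γ n → LStep (m ⊗ n) (lrcv ℓ γ) (m' ⊗ n)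
    l⊗rcvʳ : ∀ {m n n' ℓ γ} → LStep n (lrcv ℓ γ) n' → ¬ HasRcv ℓ γ m → LStep (m ⊗ n) (lrcv ℓ γ) (m ⊗ n')

  infixl 3 _∨_ _∧_
  data DMon : Set where
    [_]_ : LMon → Loc → DMon
    _∨_  : DMon → DMon → DMon
    _∧_  : DMon → DMon → DMon

  data DRecv (G : Subset nL) (ℓ' : Loc) (γ : Con) : DMon → DMon → Set where
    rloc   : ∀ {m m' ℓ} → LStep m (lrcv ℓ' γ) m' → ℓ ∈ G → DRecv G ℓ' γ ([ m ] ℓ) ([ m' ] ℓ)
    rskip₁ : ∀ {m ℓ} → ¬ (∃ λ m' → LStep m (lrcv ℓ' γ) m') → DRecv G ℓ' γ ([ m ] ℓ) ([ m ] ℓ)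
    rskip₂ : ∀ {m ℓ} → ℓ ∉ G → DRecv G ℓ' γ ([ m ] ℓ) ([ m ] ℓ)
    r∨     : ∀ {M N M' N'} → DRecv G ℓ' γ M M' → DRecv G ℓ' γ N N' → DRecv G ℓ' γ (M ∨ N) (M' ∨ N')
    r∧     : ∀ {M N M' N'} → DRecv G ℓ' γ M M' → DRecv G ℓ' γ N N' → DRecv G ℓ' γ (M ∧ N) (M' ∧ N')

  data DSend (ℓ : Loc) (G : Subset nL) (γ : Con) : DMon → DMon → Set where
    sloc : ∀ {m m'} → LStep m (lsnd G γ) m' → DSend ℓ G γ ([ m ] ℓ) ([ m' ] ℓ)
    s∨ˡ  : ∀ {M N M' N'} → DSend ℓ G γ M M' → DRecv G ℓ γ N N' → DSend ℓ G γ (M ∨ N) (M' ∨ N')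
    s∨ʳ  : ∀ {M N M' N'} → DSend ℓ G γ N N' → DRecv G ℓ γ M M' → DSend ℓ G γ (M ∨ N) (M' ∨ N')
    s∧ˡ  : ∀ {M N M' N'} → DSend ℓ G γ M M' → DRecv G ℓ γ N N' → DSend ℓ G γ (M ∧ N) (M' ∧ N')
    s∧ʳ  : ∀ {M N M' N'} → DSend ℓ G γ N N' → DRecv G ℓ γ M M' → DSend ℓ G γ (M ∧ N) (M' ∧ N')

  data DStep : DMon → Assign → DMon → Set where
    dact : ∀ {m m' ℓ A a} → A ℓ ≡ a → LStep m (act a) m' → DStep ([ m ] ℓ) A ([ m' ] ℓ)
    dend : ∀ {m ℓ A a} → A ℓ ≡ a
         → ¬ (∃ λ m' → LStep m (act a) m')
         → (∀ λ' m' → IsComm λ' → ¬ LStep m λ' m')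
         → DStep ([ m ] ℓ) A ([ verd end ] ℓ)
    d∨   : ∀ {M N M' N' A} → DStep M A M' → DStep N A N' → DStep (M ∨ N) A (M' ∨ N')
    d∧   : ∀ {M N M' N' A} → DStep M A M' → DStep N A N' → DStep (M ∧ N) A (M' ∧ N')

  data DVerd : DMon → Verdict → Set where
    vloc    : ∀ {m ℓ v} → m ⇛ v → DVerd ([ m ] ℓ) v
    v∨end   : ∀ {M N} → DVerd M end → DVerd N end → DVerd (M ∨ N) end
    v∧end   : ∀ {M N} → DVerd M end → DVerd N end → DVerd (M ∧ N) end
    v∧noˡ   : ∀ {M N} → DVerd M no → DVerd (M ∧ N) no
    v∧noʳ   : ∀ {M N} → DVerd N no → DVerd (M ∧ N) no
    v∧yesˡ  : ∀ {M N v} → DVerd M yes → DVerd N v → DVerd (M ∧ N) v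
    v∧yesʳ  : ∀ {M N v} → DVerd N yes → DVerd M v → DVerd (M ∧ N) v
    v∨yesˡ  : ∀ {M N} → DVerd M yes → DVerd (M ∨ N) yes
    v∨yesʳ  : ∀ {M N} → DVerd N yes → DVerd (M ∨ N) yes
    v∨noˡ   : ∀ {M N v} → DVerd M no → DVerd N v → DVerd (M ∨ N) v
    v∨noʳ   : ∀ {M N v} → DVerd N no → DVerd M v → DVerd (M ∨ N) v

  DComm : DMon → DMon → Set
  DComm M M' = ∃ λ ℓ → ∃ λ G → ∃ λ γ → DSend ℓ G γ M M'

  _⇒c_ : DMon → DMon → Set
  M ⇒c M' = Star DComm M M'

  data DConf : Set where
    _▷_  : DMon → HTrc → DConf
    done : Verdict → DConf

  data DInstr : DConf → DConf → Set where
    dstep    : ∀ {M M' T T' A} → DStep M A M' → TStep T A T' → DInstr (M ▷ T) (M' ▷ T')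
    dcomm    : ∀ {M M' T ℓ G γ} → DSend ℓ G γ M M' → DInstr (M ▷ T) (M' ▷ T)
    dverdict : ∀ {M T v} → DVerd M v → DInstr (M ▷ T) (done v)

  record IsWeakBisim (R : DMon → CMon → Set) : Set where
    field
      wb-verdict : ∀ {M m} → R M m → ∀ v →
                   ((∃ λ M' → (M ⇒c M') × DVerd M' v) → m ⇛ v) ×
                   (m ⇛ v → ∃ λ M' → (M ⇒c M') × DVerd M' v)
      wb-act     : ∀ {M m} → R M m → ∀ {A M'} → DStep M A M' →
                   ∃ λ m' → CStep m A m' × R M' m'
      wb-comm    : ∀ {M m} → R M m → ∀ {ℓ G γ M'} → DSend ℓ G γ M M' → R M' m
      wb-cact    : ∀ {M m} → R M m → ∀ {A m'} → CStep m A m' →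
                   ∃ λ M₁ → ∃ λ M₂ → ∃ λ M' →
                     (M ⇒c M₁) × DStep M₁ A M₂ × (M₂ ⇒c M') × R M' m'

{-# OPTIONS --safe #-}
module Submission where

open import Defs
open import Data.Nat using (ℕ; _≤_)
open import Data.Product using (_×_; _,_; proj₁; proj₂)
open import Relation.Binary.Construct.Closure.ReflexiveTransitive using (Star; ε; _◅_; _◅◅_)

-- Induction on the run: an action step of either monitor is matched by clause (2) or (4)
-- of the weak bisimulation, a communication step keeps the pair related by (3), and the
-- final verdict transfers by (1); communications are themselves instrumentation steps.
module _ {nA nL nE : ℕ} {R : DMon nA nL nE → CMon nA nL nE → Set}
         (W : IsWeakBisim nA nL nE R) where

  open IsWeakBisim W

  ⇒c⇒instr : ∀ {M M'} T → _⇒c_ nA nL nE M M' → Star (DInstr nA nL nE) (M ▷ T) (M' ▷ T)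
  ⇒c⇒instr T ε                     = ε
  ⇒c⇒instr T ((_ , _ , _ , s) ◅ ss) = dcomm s ◅ ⇒c⇒instr T ss

  dRun⇒cRun : ∀ {M m T v} → R M m →
              Star (DInstr nA nL nE) (M ▷ T) (done v) → Star (CInstr nA nL nE) (m ▷ T) (done v)
  dRun⇒cRun r (dstep s ts ◅ run) with wb-act r s
  ... | _ , cs , r' = cstep cs ts ◅ dRun⇒cRun r' run
  dRun⇒cRun r (dcomm s ◅ run)  = dRun⇒cRun (wb-comm r s) run
  dRun⇒cRun {M} {v = v} r (dverdict d ◅ ε) = cverdict (proj₁ (wb-verdict r v) (M , ε , d)) ◅ ε
  dRun⇒cRun r (dverdict d ◅ () ◅ _)

  cRun⇒dRun : ∀ {M m T v} → R M m →
              Star (CInstr nA nL nE) (m ▷ T) (done v) → Star (DInstr nA nL nE) (M ▷ T) (done v)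
  cRun⇒dRun {T = T} r (cstep {T' = T'} cs ts ◅ run) with wb-cact r cs
  ... | _ , _ , _ , comms₁ , ds , comms₂ , r' =
    ⇒c⇒instr T comms₁ ◅◅ dstep ds ts ◅ ⇒c⇒instr T' comms₂ ◅◅ cRun⇒dRun r' run
  cRun⇒dRun {T = T} {v} r (cverdict e ◅ ε) with proj₂ (wb-verdict r v) e
  ... | _ , comms , d = ⇒c⇒instr T comms ◅◅ dverdict d ◅ ε
  cRun⇒dRun r (cverdict e ◅ () ◅ _)

-- The bounds on |Act| and |𝓛| are unused: the transfer never inspects actions or locations.
proposition4p4 : (nA nL nE : ℕ) → 2 ≤ nA → 1 ≤ nL →
    (R : DMon nA nL nE → CMon nA nL nE → Set) → IsWeakBisim nA nL nE R →
    (M : DMon nA nL nE) (m : CMon nA nL nE) → R M m →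
    (T : HTrc nA nL nE) (v : Verdict) →
    (Star (DInstr nA nL nE) (M ▷ T) (done v) → Star (CInstr nA nL nE) (m ▷ T) (done v)) ×
    (Star (CInstr nA nL nE) (m ▷ T) (done v) → Star (DInstr nA nL nE) (M ▷ T) (done v))
proposition4p4 _ _ _ _ _ _ W _ _ r _ _ = dRun⇒cRun W r , cRun⇒dRun W r
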